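{- Let $A$ be a formula and let $u_0,u_1$ be closed $\mathcal{L}^+$-terms of type $[A]$ and $v_0,v_1$ closed $\mathcal{L}^+$-terms of type $\langle A\rangle$. If $u_0 \equiv u_1$ and $v_0\equiv v_1$ (in the sense of provability in $\mathsf{QF}$), then $\vdash_{\mathsf{QF}} \mathcal{W}(A,u_0,v_0) \leftrightarrow \mathcal{W}(A,u_1,v_1)$.
   Context: Fix a first-order vocabulary $\mathcal{L}$ (with at least one constant and one unary predicate). Types: $U ::= \iota \mid \Box \mid U\times U \mid U \to U$. $\mathcal{L}^+$-terms: $\varepsilon:\Box$; $\mathcal{L}$-terms (individual variables are variables of type $\iota$) have type $\iota$; pairs $(s,t):U\times V$; projections $\pi_i(s):U_i$ for $s:U_1\times U_2$; $\lambda x.t:U\to V$; application $st:V$; and $\mathrm{case}_A(u,v):U$ for $u,v:U$ and $A$ a proposition. Propositions: closed under $\vee,\neg$, containing $R(t_1,\dots,t_n)$ for relation symbols $R$ of $\mathcal{L}$ and $t_i:\iota$, and $u_1\equiv u_2$ for $u_1,u_2$ of the same type; $\to,\wedge,\leftrightarrow$ are the usual abbreviations. Reduction $\longrightarrow$ is the compatible closure of $(\lambda x.u)v\to u[v/x]$, $\pi_1(u,v)\to u$, $\pi_2(u,v)\to v$, $f(\mathrm{case}_A(u,v))\to\mathrm{case}_A(fu,fv)$, $(\mathrm{case}_A(f,g))u\to \mathrm{case}_A(fu,gu)$; terms are convertible if related by the equivalence relation generated by $\longrightarrow$. The calculus $\mathsf{QF}$ has as axioms all instances of propositional tautologies, all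 equations $u\equiv v$ with $u,v$ convertible, and all $A\to \mathrm{case}_A(u,v)\equiv u$ and $\neg A\to\mathrm{case}_A(u,v)\equiv v$; its rules are modus ponens and substitution (from $A[u/x]$ and $u\equiv v$ infer $A[v/x]$). $\vdash_{\mathsf{QF}} A$ means $A$ is provable in $\mathsf{QF}$, and $u\equiv v$ for terms means $\vdash_{\mathsf{QF}} u \equiv v$. Formulas are first-order formulas built from atomic formulas $R(t_1,\dots,t_n)$ using $\vee$, $\neg$ and $\exists$, where terms may be $\mathcal{L}^+$-terms of type $\iota$. Evidence type $[A]$ and counter-evidence type $\langle A\rangle$: $[A]=\langle A\rangle=\Box$ for atomic $A$; $[\exists x A]=\iota\times\langle\neg A\rangle$; $\langle\exists xA\rangle = [\exists xA]\to[\neg A]$; $[\neg A] = (\langle A\rangle\to[A])\to\langle A\rangle$; $\langle\neg A\rangle = \langle A\rangle\to [A]$; $[A\vee B]=\langle\neg A\rangle\times\langle\neg B\rangle$; $\langle A\vee B\rangle = (\langle\neg A\rangle\to[\neg A])\times(\langle\neg B\rangle\to[\neg B])$. For a formula $A$ and closed $u:[A]$, $v:\langle A\rangle$ the proposition $\mathcal{W}(A,u,v)$ is defined by recursion on $A$: $\mathcal{W}(R(t_1,\dots,t_n),u,v)=R(t_1,\dots,t_n)$; $\mathcal{W}(\exists xA,u,v) = \mathcal{W}\big(A[\pi_1(u)/x],\ (\pi_2(u))((v(u))(\pi_2(u))),\ (v(u))(\pi_2(u))\big)$; with $a = ((\pi_1(v))(\pi_1(u)))(\pi_1(u))$ and $b=((\pi_2(v))(\pi_2(u)))(\pi_2(u))$,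 $\mathcal{W}(A\vee B,u,v)=\mathcal{W}(A,(\pi_1(u))a,a)\vee \mathcal{W}(B,(\pi_2(u))b,b)$; $\mathcal{W}(\neg A,u,v) = \neg\,\mathcal{W}(A, v(u(v)), u(v))$. -}

module Defs where

open import Data.Nat using (ℕ; zero; suc)
open import Data.Fin using (Fin)
open import Data.Bool using (Bool; true; _∨_; not)
open import Data.List using (List; []; _∷_)
open import Data.Vec using (Vec; []; _∷_)
open import Relation.Binary.PropositionalEquality using (_≡_)
open import Relation.Binary.Construct.Closure.Equivalence using (EqClosure)

record Vocabulary : Set₁ where
  field
    FunSym   : Set
    funArity : FunSym → ℕ
    RelSym   : Set
    relArity : RelSym → ℕ
    someConst      : FunSym
    someConst-ar   : funArity someConst ≡ 0
    somePred       : RelSym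
    somePred-ar    : relArity somePred ≡ 1

data Ty : Set where
  ι   : Ty
  □   : Ty
  _⊗_ : Ty → Ty → Ty
  _⇒_ : Ty → Ty → Ty

infixr 7 _⊗_
infixr 6 _⇒_

Ctx : Set
Ctx = List Ty

ιs : ℕ → Ctx
ιs zero    = []
ιs (suc n) = ι ∷ ιs n

data _∋_ : Ctx → Ty → Set where
  here  : ∀ {Γ U} → (U ∷ Γ) ∋ U
  there : ∀ {Γ U V} → Γ ∋ U → (V ∷ Γ) ∋ U

-- Propositional formulas over k propositional variables (schemata for tautologies)
data PF (k : ℕ) : Set where
  pv   : Fin k → PF k
  _∨′_ : PF k → PF k → PF k
  ¬′_  : PF k → PF k

evalPF : ∀ {k} → (Fin k → Bool) → PF k → Bool
evalPF ρ (pv i)   = ρ i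
evalPF ρ (φ ∨′ ψ) = evalPF ρ φ ∨ evalPF ρ ψ
evalPF ρ (¬′ φ)   = not (evalPF ρ φ)

Tautology : ∀ {k} → PF k → Set
Tautology φ = ∀ ρ → evalPF ρ φ ≡ true

module Lang (L : Vocabulary) where
  open Vocabulary L

  infixr 5 _∨ₚ_
  infix 6 ¬ₚ_

  mutual
    data Tm (Γ : Ctx) : Ty → Set where
      var  : ∀ {U} → Γ ∋ U → Tm Γ U
      ε    : Tm Γ □
      fun  : (f : FunSym) → Vec (Tm Γ ι) (funArity f) → Tm Γ ι
      pair : ∀ {U V} → Tm Γ U → Tm Γ V → Tm Γ (U ⊗ V)
      π₁   : ∀ {U V} → Tm Γ (U ⊗ V) → Tm Γ U
      π₂   : ∀ {U V} → Tm Γ (U ⊗ V) → Tm Γ V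
      lam  : ∀ {U V} → Tm (U ∷ Γ) V → Tm Γ (U ⇒ V)
      app  : ∀ {U V} → Tm Γ (U ⇒ V) → Tm Γ U → Tm Γ V
      case : ∀ {U} → Prp Γ → Tm Γ U → Tm Γ U → Tm Γ U

    data Prp (Γ : Ctx) : Set where
      rel   : (R : RelSym) → Vec (Tm Γ ι) (relArity R) → Prp Γ
      eq    : (U : Ty) → Tm Γ U → Tm Γ U → Prp Γ
      _∨ₚ_  : Prp Γ → Prp Γ → Prp Γ
      ¬ₚ_   : Prp Γ → Prp Γ

  _⇒ₚ_ : ∀ {Γ} → Prp Γ → Prp Γ → Prp Γ
  A ⇒ₚ B = (¬ₚ A) ∨ₚ B

  _∧ₚ_ : ∀ {Γ} → Prp Γ → Prp Γ → Prp Γ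
  A ∧ₚ B = ¬ₚ ((¬ₚ A) ∨ₚ (¬ₚ B))

  _⇔ₚ_ : ∀ {Γ} → Prp Γ → Prp Γ → Prp Γ
  A ⇔ₚ B = (A ⇒ₚ B) ∧ₚ (B ⇒ₚ A)

  Ren : Ctx → Ctx → Set
  Ren Γ Δ = ∀ {U} → Γ ∋ U → Δ ∋ U

  extR : ∀ {Γ Δ V} → Ren Γ Δ → Ren (V ∷ Γ) (V ∷ Δ)
  extR ρ here      = here
  extR ρ (there x) = there (ρ x)

  mutual
    ren : ∀ {Γ Δ U} → Ren Γ Δ → Tm Γ U → Tm Δ U
    ren ρ (var x)      = var (ρ x)
    ren ρ ε            = ε
    ren ρ (fun f ts)   = fun f (renV ρ ts)
    ren ρ (pair s t)   = pair (ren ρ s) (ren ρ t)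
    ren ρ (π₁ t)       = π₁ (ren ρ t)
    ren ρ (π₂ t)       = π₂ (ren ρ t)
    ren ρ (lam t)      = lam (ren (extR ρ) t)
    ren ρ (app s t)    = app (ren ρ s) (ren ρ t)
    ren ρ (case A s t) = case (renP ρ A) (ren ρ s) (ren ρ t)

    renV : ∀ {Γ Δ k} → Ren Γ Δ → Vec (Tm Γ ι) k → Vec (Tm Δ ι) k
    renV ρ []       = []
    renV ρ (t ∷ ts) = ren ρ t ∷ renV ρ ts

    renP : ∀ {Γ Δ} → Ren Γ Δ → Prp Γ → Prp Δ
    renP ρ (rel R ts) = rel R (renV ρ ts)
    renP ρ (eq U s t) = eq U (ren ρ s) (ren ρ t)
    renP ρ (A ∨ₚ B)   = renP ρ A ∨ₚ renP ρ B
    renP ρ (¬ₚ A)     = ¬ₚ renP ρ A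

  Sub : Ctx → Ctx → Set
  Sub Γ Δ = ∀ {U} → Γ ∋ U → Tm Δ U

  extS : ∀ {Γ Δ V} → Sub Γ Δ → Sub (V ∷ Γ) (V ∷ Δ)
  extS σ here      = var here
  extS σ (there x) = ren there (σ x)

  mutual
    sub : ∀ {Γ Δ U} → Sub Γ Δ → Tm Γ U → Tm Δ U
    sub σ (var x)      = σ x
    sub σ ε            = ε
    sub σ (fun f ts)   = fun f (subV σ ts)
    sub σ (pair s t)   = pair (sub σ s) (sub σ t)
    sub σ (π₁ t)       = π₁ (sub σ t)
    sub σ (π₂ t)       = π₂ (sub σ t)
    sub σ (lam t)      = lam (sub (extS σ) t)
    sub σ (app s t)    = app (sub σ s) (sub σ t)
    sub σ (case A s t) = case (subP σ A) (sub σ s) (sub σ t)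

    subV : ∀ {Γ Δ k} → Sub Γ Δ → Vec (Tm Γ ι) k → Vec (Tm Δ ι) k
    subV σ []       = []
    subV σ (t ∷ ts) = sub σ t ∷ subV σ ts

    subP : ∀ {Γ Δ} → Sub Γ Δ → Prp Γ → Prp Δ
    subP σ (rel R ts) = rel R (subV σ ts)
    subP σ (eq U s t) = eq U (sub σ s) (sub σ t)
    subP σ (A ∨ₚ B)   = subP σ A ∨ₚ subP σ B
    subP σ (¬ₚ A)     = ¬ₚ subP σ A

  _∷ˢ_ : ∀ {Γ Δ U} → Tm Δ U → Sub Γ Δ → Sub (U ∷ Γ) Δ
  (t ∷ˢ σ) here      = t
  (t ∷ˢ σ) (there x) = σ x

  _⟦_⟧ : ∀ {Γ U V} → Tm (U ∷ Γ) V → Tm Γ U → Tm Γ V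
  t ⟦ s ⟧ = sub (s ∷ˢ var) t

  _⟦_⟧ₚ : ∀ {Γ U} → Prp (U ∷ Γ) → Tm Γ U → Prp Γ
  A ⟦ s ⟧ₚ = subP (s ∷ˢ var) A

  close : ∀ {Γ U} → Tm [] U → Tm Γ U
  close = ren (λ ())

  infix 4 _⟶_ _⟶ₚ_ _⟶ᵥ_
  mutual
    data _⟶_ {Γ : Ctx} : ∀ {U} → Tm Γ U → Tm Γ U → Set where
      β        : ∀ {U V} {u : Tm (U ∷ Γ) V} {v : Tm Γ U} → app (lam u) v ⟶ u ⟦ v ⟧
      π₁β      : ∀ {U V} {u : Tm Γ U} {v : Tm Γ V} → π₁ (pair u v) ⟶ u
      π₂β      : ∀ {U V} {u : Tm Γ U} {v : Tm Γ V} → π₂ (pair u v) ⟶ v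
      app-case : ∀ {U V} {A} {f : Tm Γ (U ⇒ V)} {u v : Tm Γ U} →
                 app f (case A u v) ⟶ case A (app f u) (app f v)
      case-app : ∀ {U V} {A} {f g : Tm Γ (U ⇒ V)} {u : Tm Γ U} →
                 app (case A f g) u ⟶ case A (app f u) (app g u)
      ξ-fun    : ∀ {f} {ts ts' : Vec (Tm Γ ι) (funArity f)} → ts ⟶ᵥ ts' → fun f ts ⟶ fun f ts'
      ξ-pairₗ  : ∀ {U V} {u u' : Tm Γ U} {v : Tm Γ V} → u ⟶ u' → pair u v ⟶ pair u' v
      ξ-pairᵣ  : ∀ {U V} {u : Tm Γ U} {v v' : Tm Γ V} → v ⟶ v' → pair u v ⟶ pair u v'
      ξ-π₁     : ∀ {U V} {t t' : Tm Γ (U ⊗ V)} → t ⟶ t' → π₁ t ⟶ π₁ t'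
      ξ-π₂     : ∀ {U V} {t t' : Tm Γ (U ⊗ V)} → t ⟶ t' → π₂ t ⟶ π₂ t'
      ξ-lam    : ∀ {U V} {t t' : Tm (U ∷ Γ) V} → t ⟶ t' → lam t ⟶ lam t'
      ξ-appₗ   : ∀ {U V} {s s' : Tm Γ (U ⇒ V)} {t : Tm Γ U} → s ⟶ s' → app s t ⟶ app s' t
      ξ-appᵣ   : ∀ {U V} {s : Tm Γ (U ⇒ V)} {t t' : Tm Γ U} → t ⟶ t' → app s t ⟶ app s t'
      ξ-caseₚ  : ∀ {U} {A A'} {s t : Tm Γ U} → A ⟶ₚ A' → case A s t ⟶ case A' s t
      ξ-caseₗ  : ∀ {U} {A} {s s' t : Tm Γ U} → s ⟶ s' → case A s t ⟶ case A s' t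
      ξ-caseᵣ  : ∀ {U} {A} {s t t' : Tm Γ U} → t ⟶ t' → case A s t ⟶ case A s t'

    data _⟶ᵥ_ {Γ : Ctx} : ∀ {k} → Vec (Tm Γ ι) k → Vec (Tm Γ ι) k → Set where
      hd : ∀ {k} {t t'} {ts : Vec (Tm Γ ι) k} → t ⟶ t' → (t ∷ ts) ⟶ᵥ (t' ∷ ts)
      tl : ∀ {k} {t} {ts ts' : Vec (Tm Γ ι) k} → ts ⟶ᵥ ts' → (t ∷ ts) ⟶ᵥ (t ∷ ts')

    data _⟶ₚ_ {Γ : Ctx} : Prp Γ → Prp Γ → Set where
      ξ-rel : ∀ {R} {ts ts' : Vec (Tm Γ ι) (relArity R)} → ts ⟶ᵥ ts' → rel R ts ⟶ₚ rel R ts'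
      ξ-eqₗ : ∀ {U} {s s' t : Tm Γ U} → s ⟶ s' → eq U s t ⟶ₚ eq U s' t
      ξ-eqᵣ : ∀ {U} {s t t' : Tm Γ U} → t ⟶ t' → eq U s t ⟶ₚ eq U s t'
      ξ-∨ₗ  : ∀ {A A' B} → A ⟶ₚ A' → (A ∨ₚ B) ⟶ₚ (A' ∨ₚ B)
      ξ-∨ᵣ  : ∀ {A B B'} → B ⟶ₚ B' → (A ∨ₚ B) ⟶ₚ (A ∨ₚ B')
      ξ-¬   : ∀ {A A'} → A ⟶ₚ A' → (¬ₚ A) ⟶ₚ (¬ₚ A')

  Convertible : ∀ {Γ U} → Tm Γ U → Tm Γ U → Set
  Convertible {Γ} {U} = EqClosure (_⟶_ {Γ} {U})

  inst : ∀ {Γ k} → PF k → (Fin k → Prp Γ) → Prp Γ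
  inst (pv i)   σ = σ i
  inst (φ ∨′ ψ) σ = inst φ σ ∨ₚ inst ψ σ
  inst (¬′ φ)   σ = ¬ₚ inst φ σ

  data ⊢QF_ {Γ : Ctx} : Prp Γ → Set where
    ax-taut  : ∀ {k} (φ : PF k) → Tautology φ → (σ : Fin k → Prp Γ) → ⊢QF inst φ σ
    ax-conv  : ∀ {U} (u v : Tm Γ U) → Convertible u v → ⊢QF eq U u v
    ax-caseT : ∀ {U} (A : Prp Γ) (u v : Tm Γ U) → ⊢QF (A ⇒ₚ eq U (case A u v) u)
    ax-caseF : ∀ {U} (A : Prp Γ) (u v : Tm Γ U) → ⊢QF ((¬ₚ A) ⇒ₚ eq U (case A u v) v)
    mp       : ∀ {A B : Prp Γ} → ⊢QF A → ⊢QF (A ⇒ₚ B) → ⊢QF B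
    subst    : ∀ {U} (A : Prp (U ∷ Γ)) (u v : Tm Γ U) →
               ⊢QF (A ⟦ u ⟧ₚ) → ⊢QF eq U u v → ⊢QF (A ⟦ v ⟧ₚ)

  data Fm (n : ℕ) : Set where
    atom : (R : RelSym) → Vec (Tm (ιs n) ι) (relArity R) → Fm n
    _∨f_ : Fm n → Fm n → Fm n
    ¬f_  : Fm n → Fm n
    ∃f   : Fm (suc n) → Fm n

  -- evidence and counter-evidence types (the references to ¬A are unfolded
  -- one step so that the recursion is structural; definitionally the same)
  mutual
    [_] : ∀ {n} → Fm n → Ty
    [ atom R ts ] = □
    [ ∃f A ]      = ι ⊗ (⟨ A ⟩ ⇒ [ A ])                  -- ι × ⟨¬A⟩
    [ ¬f A ]      = (⟨ A ⟩ ⇒ [ A ]) ⇒ ⟨ A ⟩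
    [ A ∨f B ]    = (⟨ A ⟩ ⇒ [ A ]) ⊗ (⟨ B ⟩ ⇒ [ B ])     -- ⟨¬A⟩ × ⟨¬B⟩

    ⟨_⟩ : ∀ {n} → Fm n → Ty
    ⟨ atom R ts ⟩ = □
    ⟨ ∃f A ⟩      = (ι ⊗ (⟨ A ⟩ ⇒ [ A ])) ⇒ ((⟨ A ⟩ ⇒ [ A ]) ⇒ ⟨ A ⟩)   -- [∃xA] → [¬A]
    ⟨ ¬f A ⟩      = ⟨ A ⟩ ⇒ [ A ]
    ⟨ A ∨f B ⟩    = ((⟨ A ⟩ ⇒ [ A ]) ⇒ ((⟨ A ⟩ ⇒ [ A ]) ⇒ ⟨ A ⟩))
                  ⊗ ((⟨ B ⟩ ⇒ [ B ]) ⇒ ((⟨ B ⟩ ⇒ [ B ]) ⇒ ⟨ B ⟩))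
                  -- (⟨¬A⟩ → [¬A]) × (⟨¬B⟩ → [¬B])

  -- W(A[σ], u, v), carrying the pending substitution σ of the
  -- free individual variables of A (needed for structural recursion).
  Wσ : ∀ {m n} (A : Fm m) → Sub (ιs m) (ιs n) → Tm [] [ A ] → Tm [] ⟨ A ⟩ → Prp (ιs n)
  Wσ (atom R ts) σ u v = rel R (subV σ ts)
  Wσ (∃f A) σ u v =
    Wσ A (close (π₁ u) ∷ˢ σ) (app (π₂ u) (app (app v u) (π₂ u))) (app (app v u) (π₂ u))
  Wσ (A ∨f B) σ u v =
    Wσ A σ (app (π₁ u) a) a ∨ₚ Wσ B σ (app (π₂ u) b) b
    where
      a = app (app (π₁ v) (π₁ u)) (π₁ u)
      b = app (app (π₂ v) (π₂ u)) (π₂ u)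
  Wσ (¬f A) σ u v = ¬ₚ Wσ A σ (app v (app u v)) (app u v)

  W : ∀ {n} (A : Fm n) → Tm [] [ A ] → Tm [] ⟨ A ⟩ → Prp (ιs n)
  W A u v = Wσ A var u v

module Submission where

-- W(A, u, v) is the instance at u of a proposition with a free variable of type [A]
-- (and likewise for v), once W is extended to open evidence. So the
-- substitution rule of QF turns u₀ ≡ u₁ into W(A,u₀,v₀) ⇔ W(A,u₁,v₀), and then
-- v₀ ≡ v₁ into W(A,u₁,v₀) ⇔ W(A,u₁,v₁). The only technical point is that the
-- hypotheses live in the empty context, so QF derivations must first be weakened
-- into the context of the free variables of A, which needs the usual
-- renaming/substitution fusion laws.

open import Defs
open import Data.Nat using (ℕ)
open import Data.List using ([]; _∷_)
open import Data.Fin using (Fin; zero; suc)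
open import Data.Bool using (true; false)
open import Data.Vec using (Vec; []; _∷_; lookup)
open import Relation.Binary.PropositionalEquality as Eq using (_≡_; refl; cong; cong₂; sym; trans)
import Relation.Binary.Construct.Closure.ReflexiveTransitive as Star
open import Relation.Binary.Construct.Closure.Symmetric using (fwd; bwd)

cong₃ : {A B C D : Set} (f : A → B → C → D) {a a' : A} {b b' : B} {c c' : C} →
        a ≡ a' → b ≡ b' → c ≡ c' → f a b c ≡ f a' b' c'
cong₃ f refl refl refl = refl

module Metatheory (L : Vocabulary) where
  open Lang L public

  _≗ᵣ_ : ∀ {Γ Δ} → Ren Γ Δ → Ren Γ Δ → Set
  _≗ᵣ_ {Γ} ρ ρ' = ∀ {U} (x : Γ ∋ U) → ρ x ≡ ρ' x

  _≗ₛ_ : ∀ {Γ Δ} → Sub Γ Δ → Sub Γ Δ → Set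
  _≗ₛ_ {Γ} σ σ' = ∀ {U} (x : Γ ∋ U) → σ x ≡ σ' x

  -- Renaming and substitution

  extR-cong : ∀ {Γ Δ V} {ρ ρ' : Ren Γ Δ} → ρ ≗ᵣ ρ' → extR {V = V} ρ ≗ᵣ extR ρ'
  extR-cong h here      = refl
  extR-cong h (there x) = cong there (h x)

  mutual
    ren-cong : ∀ {Γ Δ U} {ρ ρ' : Ren Γ Δ} → ρ ≗ᵣ ρ' → (t : Tm Γ U) → ren ρ t ≡ ren ρ' t
    ren-cong h (var x)      = cong var (h x)
    ren-cong h ε            = refl
    ren-cong h (fun f ts)   = cong (fun f) (renV-cong h ts)
    ren-cong h (pair s t)   = cong₂ pair (ren-cong h s) (ren-cong h t)
    ren-cong h (π₁ t)       = cong π₁ (ren-cong h t)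
    ren-cong h (π₂ t)       = cong π₂ (ren-cong h t)
    ren-cong h (lam t)      = cong lam (ren-cong (extR-cong h) t)
    ren-cong h (app s t)    = cong₂ app (ren-cong h s) (ren-cong h t)
    ren-cong h (case A s t) = cong₃ case (renP-cong h A) (ren-cong h s) (ren-cong h t)

    renV-cong : ∀ {Γ Δ k} {ρ ρ' : Ren Γ Δ} → ρ ≗ᵣ ρ' → (ts : Vec (Tm Γ ι) k) →
                renV ρ ts ≡ renV ρ' ts
    renV-cong h []       = refl
    renV-cong h (t ∷ ts) = cong₂ _∷_ (ren-cong h t) (renV-cong h ts)

    renP-cong : ∀ {Γ Δ} {ρ ρ' : Ren Γ Δ} → ρ ≗ᵣ ρ' → (A : Prp Γ) → renP ρ A ≡ renP ρ' A
    renP-cong h (rel R ts) = cong (rel R) (renV-cong h ts)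
    renP-cong h (eq U s t) = cong₂ (eq U) (ren-cong h s) (ren-cong h t)
    renP-cong h (A ∨ₚ B)   = cong₂ _∨ₚ_ (renP-cong h A) (renP-cong h B)
    renP-cong h (¬ₚ A)     = cong ¬ₚ_ (renP-cong h A)

  extS-cong : ∀ {Γ Δ V} {σ σ' : Sub Γ Δ} → σ ≗ₛ σ' → extS {V = V} σ ≗ₛ extS σ'
  extS-cong h here      = refl
  extS-cong h (there x) = cong (ren there) (h x)

  mutual
    sub-cong : ∀ {Γ Δ U} {σ σ' : Sub Γ Δ} → σ ≗ₛ σ' → (t : Tm Γ U) → sub σ t ≡ sub σ' t
    sub-cong h (var x)      = h x
    sub-cong h ε            = refl
    sub-cong h (fun f ts)   = cong (fun f) (subV-cong h ts)
    sub-cong h (pair s t)   = cong₂ pair (sub-cong h s) (sub-cong h t)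
    sub-cong h (π₁ t)       = cong π₁ (sub-cong h t)
    sub-cong h (π₂ t)       = cong π₂ (sub-cong h t)
    sub-cong h (lam t)      = cong lam (sub-cong (extS-cong h) t)
    sub-cong h (app s t)    = cong₂ app (sub-cong h s) (sub-cong h t)
    sub-cong h (case A s t) = cong₃ case (subP-cong h A) (sub-cong h s) (sub-cong h t)

    subV-cong : ∀ {Γ Δ k} {σ σ' : Sub Γ Δ} → σ ≗ₛ σ' → (ts : Vec (Tm Γ ι) k) →
                subV σ ts ≡ subV σ' ts
    subV-cong h []       = refl
    subV-cong h (t ∷ ts) = cong₂ _∷_ (sub-cong h t) (subV-cong h ts)

    subP-cong : ∀ {Γ Δ} {σ σ' : Sub Γ Δ} → σ ≗ₛ σ' → (A : Prp Γ) → subP σ A ≡ subP σ' A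
    subP-cong h (rel R ts) = cong (rel R) (subV-cong h ts)
    subP-cong h (eq U s t) = cong₂ (eq U) (sub-cong h s) (sub-cong h t)
    subP-cong h (A ∨ₚ B)   = cong₂ _∨ₚ_ (subP-cong h A) (subP-cong h B)
    subP-cong h (¬ₚ A)     = cong ¬ₚ_ (subP-cong h A)

  extS-var : ∀ {Γ V} → extS {Γ} {Γ} {V} var ≗ₛ var
  extS-var here      = refl
  extS-var (there x) = refl

  mutual
    sub-var : ∀ {Γ U} (t : Tm Γ U) → sub var t ≡ t
    sub-var (var x)      = refl
    sub-var ε            = refl
    sub-var (fun f ts)   = cong (fun f) (subV-var ts)
    sub-var (pair s t)   = cong₂ pair (sub-var s) (sub-var t)
    sub-var (π₁ t)       = cong π₁ (sub-var t)
    sub-var (π₂ t)       = cong π₂ (sub-var t)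
    sub-var (lam t)      = cong lam (trans (sub-cong extS-var t) (sub-var t))
    sub-var (app s t)    = cong₂ app (sub-var s) (sub-var t)
    sub-var (case A s t) = cong₃ case (subP-var A) (sub-var s) (sub-var t)

    subV-var : ∀ {Γ k} (ts : Vec (Tm Γ ι) k) → subV var ts ≡ ts
    subV-var []       = refl
    subV-var (t ∷ ts) = cong₂ _∷_ (sub-var t) (subV-var ts)

    subP-var : ∀ {Γ} (A : Prp Γ) → subP var A ≡ A
    subP-var (rel R ts) = cong (rel R) (subV-var ts)
    subP-var (eq U s t) = cong₂ (eq U) (sub-var s) (sub-var t)
    subP-var (A ∨ₚ B)   = cong₂ _∨ₚ_ (subP-var A) (subP-var B)
    subP-var (¬ₚ A)     = cong ¬ₚ_ (subP-var A)

  mutual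
    ren-ren : ∀ {Γ Δ Θ U} (ρ' : Ren Δ Θ) (ρ : Ren Γ Δ) (t : Tm Γ U) →
              ren ρ' (ren ρ t) ≡ ren (λ x → ρ' (ρ x)) t
    ren-ren ρ' ρ (var x)      = refl
    ren-ren ρ' ρ ε            = refl
    ren-ren ρ' ρ (fun f ts)   = cong (fun f) (renV-ren ρ' ρ ts)
    ren-ren ρ' ρ (pair s t)   = cong₂ pair (ren-ren ρ' ρ s) (ren-ren ρ' ρ t)
    ren-ren ρ' ρ (π₁ t)       = cong π₁ (ren-ren ρ' ρ t)
    ren-ren ρ' ρ (π₂ t)       = cong π₂ (ren-ren ρ' ρ t)
    ren-ren ρ' ρ (lam t)      = cong lam (trans (ren-ren (extR ρ') (extR ρ) t) (ren-cong ext t))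
      where ext : (λ x → extR ρ' (extR ρ x)) ≗ᵣ extR (λ x → ρ' (ρ x))
            ext here      = refl
            ext (there x) = refl
    ren-ren ρ' ρ (app s t)    = cong₂ app (ren-ren ρ' ρ s) (ren-ren ρ' ρ t)
    ren-ren ρ' ρ (case A s t) = cong₃ case (renP-ren ρ' ρ A) (ren-ren ρ' ρ s) (ren-ren ρ' ρ t)

    renV-ren : ∀ {Γ Δ Θ k} (ρ' : Ren Δ Θ) (ρ : Ren Γ Δ) (ts : Vec (Tm Γ ι) k) →
               renV ρ' (renV ρ ts) ≡ renV (λ x → ρ' (ρ x)) ts
    renV-ren ρ' ρ []       = refl
    renV-ren ρ' ρ (t ∷ ts) = cong₂ _∷_ (ren-ren ρ' ρ t) (renV-ren ρ' ρ ts)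

    renP-ren : ∀ {Γ Δ Θ} (ρ' : Ren Δ Θ) (ρ : Ren Γ Δ) (A : Prp Γ) →
               renP ρ' (renP ρ A) ≡ renP (λ x → ρ' (ρ x)) A
    renP-ren ρ' ρ (rel R ts) = cong (rel R) (renV-ren ρ' ρ ts)
    renP-ren ρ' ρ (eq U s t) = cong₂ (eq U) (ren-ren ρ' ρ s) (ren-ren ρ' ρ t)
    renP-ren ρ' ρ (A ∨ₚ B)   = cong₂ _∨ₚ_ (renP-ren ρ' ρ A) (renP-ren ρ' ρ B)
    renP-ren ρ' ρ (¬ₚ A)     = cong ¬ₚ_ (renP-ren ρ' ρ A)

  mutual
    sub-ren : ∀ {Γ Δ Θ U} (σ : Sub Δ Θ) (ρ : Ren Γ Δ) (t : Tm Γ U) →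
              sub σ (ren ρ t) ≡ sub (λ x → σ (ρ x)) t
    sub-ren σ ρ (var x)      = refl
    sub-ren σ ρ ε            = refl
    sub-ren σ ρ (fun f ts)   = cong (fun f) (subV-ren σ ρ ts)
    sub-ren σ ρ (pair s t)   = cong₂ pair (sub-ren σ ρ s) (sub-ren σ ρ t)
    sub-ren σ ρ (π₁ t)       = cong π₁ (sub-ren σ ρ t)
    sub-ren σ ρ (π₂ t)       = cong π₂ (sub-ren σ ρ t)
    sub-ren σ ρ (lam t)      = cong lam (trans (sub-ren (extS σ) (extR ρ) t) (sub-cong ext t))
      where ext : (λ x → extS σ (extR ρ x)) ≗ₛ extS (λ x → σ (ρ x))
            ext here      = refl
            ext (there x) = refl
    sub-ren σ ρ (app s t)    = cong₂ app (sub-ren σ ρ s) (sub-ren σ ρ t)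
    sub-ren σ ρ (case A s t) = cong₃ case (subP-ren σ ρ A) (sub-ren σ ρ s) (sub-ren σ ρ t)

    subV-ren : ∀ {Γ Δ Θ k} (σ : Sub Δ Θ) (ρ : Ren Γ Δ) (ts : Vec (Tm Γ ι) k) →
               subV σ (renV ρ ts) ≡ subV (λ x → σ (ρ x)) ts
    subV-ren σ ρ []       = refl
    subV-ren σ ρ (t ∷ ts) = cong₂ _∷_ (sub-ren σ ρ t) (subV-ren σ ρ ts)

    subP-ren : ∀ {Γ Δ Θ} (σ : Sub Δ Θ) (ρ : Ren Γ Δ) (A : Prp Γ) →
               subP σ (renP ρ A) ≡ subP (λ x → σ (ρ x)) A
    subP-ren σ ρ (rel R ts) = cong (rel R) (subV-ren σ ρ ts)
    subP-ren σ ρ (eq U s t) = cong₂ (eq U) (sub-ren σ ρ s) (sub-ren σ ρ t)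
    subP-ren σ ρ (A ∨ₚ B)   = cong₂ _∨ₚ_ (subP-ren σ ρ A) (subP-ren σ ρ B)
    subP-ren σ ρ (¬ₚ A)     = cong ¬ₚ_ (subP-ren σ ρ A)

  mutual
    ren-sub : ∀ {Γ Δ Θ U} (ρ : Ren Δ Θ) (σ : Sub Γ Δ) (t : Tm Γ U) →
              ren ρ (sub σ t) ≡ sub (λ x → ren ρ (σ x)) t
    ren-sub ρ σ (var x)      = refl
    ren-sub ρ σ ε            = refl
    ren-sub ρ σ (fun f ts)   = cong (fun f) (renV-sub ρ σ ts)
    ren-sub ρ σ (pair s t)   = cong₂ pair (ren-sub ρ σ s) (ren-sub ρ σ t)
    ren-sub ρ σ (π₁ t)       = cong π₁ (ren-sub ρ σ t)
    ren-sub ρ σ (π₂ t)       = cong π₂ (ren-sub ρ σ t)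
    ren-sub ρ σ (lam t)      = cong lam (trans (ren-sub (extR ρ) (extS σ) t) (sub-cong ext t))
      where ext : (λ x → ren (extR ρ) (extS σ x)) ≗ₛ extS (λ x → ren ρ (σ x))
            ext here      = refl
            ext (there x) = trans (ren-ren (extR ρ) there (σ x)) (sym (ren-ren there ρ (σ x)))
    ren-sub ρ σ (app s t)    = cong₂ app (ren-sub ρ σ s) (ren-sub ρ σ t)
    ren-sub ρ σ (case A s t) = cong₃ case (renP-sub ρ σ A) (ren-sub ρ σ s) (ren-sub ρ σ t)

    renV-sub : ∀ {Γ Δ Θ k} (ρ : Ren Δ Θ) (σ : Sub Γ Δ) (ts : Vec (Tm Γ ι) k) →
               renV ρ (subV σ ts) ≡ subV (λ x → ren ρ (σ x)) ts
    renV-sub ρ σ []       = refl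
    renV-sub ρ σ (t ∷ ts) = cong₂ _∷_ (ren-sub ρ σ t) (renV-sub ρ σ ts)

    renP-sub : ∀ {Γ Δ Θ} (ρ : Ren Δ Θ) (σ : Sub Γ Δ) (A : Prp Γ) →
               renP ρ (subP σ A) ≡ subP (λ x → ren ρ (σ x)) A
    renP-sub ρ σ (rel R ts) = cong (rel R) (renV-sub ρ σ ts)
    renP-sub ρ σ (eq U s t) = cong₂ (eq U) (ren-sub ρ σ s) (ren-sub ρ σ t)
    renP-sub ρ σ (A ∨ₚ B)   = cong₂ _∨ₚ_ (renP-sub ρ σ A) (renP-sub ρ σ B)
    renP-sub ρ σ (¬ₚ A)     = cong ¬ₚ_ (renP-sub ρ σ A)

  mutual
    sub-sub : ∀ {Γ Δ Θ U} (τ : Sub Δ Θ) (σ : Sub Γ Δ) (t : Tm Γ U) →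
              sub τ (sub σ t) ≡ sub (λ x → sub τ (σ x)) t
    sub-sub τ σ (var x)      = refl
    sub-sub τ σ ε            = refl
    sub-sub τ σ (fun f ts)   = cong (fun f) (subV-sub τ σ ts)
    sub-sub τ σ (pair s t)   = cong₂ pair (sub-sub τ σ s) (sub-sub τ σ t)
    sub-sub τ σ (π₁ t)       = cong π₁ (sub-sub τ σ t)
    sub-sub τ σ (π₂ t)       = cong π₂ (sub-sub τ σ t)
    sub-sub τ σ (lam t)      = cong lam (trans (sub-sub (extS τ) (extS σ) t) (sub-cong ext t))
      where ext : (λ x → sub (extS τ) (extS σ x)) ≗ₛ extS (λ x → sub τ (σ x))
            ext here      = refl
            ext (there x) = trans (sub-ren (extS τ) there (σ x)) (sym (ren-sub there τ (σ x)))
    sub-sub τ σ (app s t)    = cong₂ app (sub-sub τ σ s) (sub-sub τ σ t)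
    sub-sub τ σ (case A s t) = cong₃ case (subP-sub τ σ A) (sub-sub τ σ s) (sub-sub τ σ t)

    subV-sub : ∀ {Γ Δ Θ k} (τ : Sub Δ Θ) (σ : Sub Γ Δ) (ts : Vec (Tm Γ ι) k) →
               subV τ (subV σ ts) ≡ subV (λ x → sub τ (σ x)) ts
    subV-sub τ σ []       = refl
    subV-sub τ σ (t ∷ ts) = cong₂ _∷_ (sub-sub τ σ t) (subV-sub τ σ ts)

    subP-sub : ∀ {Γ Δ Θ} (τ : Sub Δ Θ) (σ : Sub Γ Δ) (A : Prp Γ) →
               subP τ (subP σ A) ≡ subP (λ x → sub τ (σ x)) A
    subP-sub τ σ (rel R ts) = cong (rel R) (subV-sub τ σ ts)
    subP-sub τ σ (eq U s t) = cong₂ (eq U) (sub-sub τ σ s) (sub-sub τ σ t)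
    subP-sub τ σ (A ∨ₚ B)   = cong₂ _∨ₚ_ (subP-sub τ σ A) (subP-sub τ σ B)
    subP-sub τ σ (¬ₚ A)     = cong ¬ₚ_ (subP-sub τ σ A)

  sub-weaken : ∀ {Γ U V} (s : Tm Γ U) (t : Tm Γ V) → (ren there t) ⟦ s ⟧ ≡ t
  sub-weaken s t = trans (sub-ren (s ∷ˢ var) there t) (sub-var t)

  subP-weaken : ∀ {Γ U} (s : Tm Γ U) (A : Prp Γ) → (renP there A) ⟦ s ⟧ₚ ≡ A
  subP-weaken s A = trans (subP-ren (s ∷ˢ var) there A) (subP-var A)

  ren-∷ˢ : ∀ {Γ Δ U} (ρ : Ren Γ Δ) (s : Tm Γ U) →
           (λ x → ren ρ ((s ∷ˢ var) x)) ≗ₛ (λ x → (ren ρ s ∷ˢ var) (extR ρ x))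
  ren-∷ˢ ρ s here      = refl
  ren-∷ˢ ρ s (there x) = refl

  ren-⟦⟧ : ∀ {Γ Δ U V} (ρ : Ren Γ Δ) (t : Tm (U ∷ Γ) V) (s : Tm Γ U) →
           ren ρ (t ⟦ s ⟧) ≡ (ren (extR ρ) t) ⟦ ren ρ s ⟧
  ren-⟦⟧ ρ t s = trans (ren-sub ρ (s ∷ˢ var) t)
                   (trans (sub-cong (ren-∷ˢ ρ s) t) (sym (sub-ren (ren ρ s ∷ˢ var) (extR ρ) t)))

  renP-⟦⟧ : ∀ {Γ Δ U} (ρ : Ren Γ Δ) (A : Prp (U ∷ Γ)) (s : Tm Γ U) →
            renP ρ (A ⟦ s ⟧ₚ) ≡ (renP (extR ρ) A) ⟦ ren ρ s ⟧ₚ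
  renP-⟦⟧ ρ A s = trans (renP-sub ρ (s ∷ˢ var) A)
                    (trans (subP-cong (ren-∷ˢ ρ s) A) (sym (subP-ren (ren ρ s ∷ˢ var) (extR ρ) A)))

  -- Weakening of reductions and derivations

  mutual
    ren-⟶ : ∀ {Γ Δ U} (ρ : Ren Γ Δ) {s t : Tm Γ U} → s ⟶ t → ren ρ s ⟶ ren ρ t
    ren-⟶ ρ (β {u = t} {s}) = Eq.subst (app (lam (ren (extR ρ) t)) (ren ρ s) ⟶_) (sym (ren-⟦⟧ ρ t s)) β
    ren-⟶ ρ π₁β         = π₁β
    ren-⟶ ρ π₂β         = π₂β
    ren-⟶ ρ app-case    = app-case
    ren-⟶ ρ case-app    = case-app
    ren-⟶ ρ (ξ-fun r)   = ξ-fun (renV-⟶ᵥ ρ r)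
    ren-⟶ ρ (ξ-pairₗ r) = ξ-pairₗ (ren-⟶ ρ r)
    ren-⟶ ρ (ξ-pairᵣ r) = ξ-pairᵣ (ren-⟶ ρ r)
    ren-⟶ ρ (ξ-π₁ r)    = ξ-π₁ (ren-⟶ ρ r)
    ren-⟶ ρ (ξ-π₂ r)    = ξ-π₂ (ren-⟶ ρ r)
    ren-⟶ ρ (ξ-lam r)   = ξ-lam (ren-⟶ (extR ρ) r)
    ren-⟶ ρ (ξ-appₗ r)  = ξ-appₗ (ren-⟶ ρ r)
    ren-⟶ ρ (ξ-appᵣ r)  = ξ-appᵣ (ren-⟶ ρ r)
    ren-⟶ ρ (ξ-caseₚ r) = ξ-caseₚ (renP-⟶ₚ ρ r)
    ren-⟶ ρ (ξ-caseₗ r) = ξ-caseₗ (ren-⟶ ρ r)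
    ren-⟶ ρ (ξ-caseᵣ r) = ξ-caseᵣ (ren-⟶ ρ r)

    renV-⟶ᵥ : ∀ {Γ Δ k} (ρ : Ren Γ Δ) {ss ts : Vec (Tm Γ ι) k} → ss ⟶ᵥ ts → renV ρ ss ⟶ᵥ renV ρ ts
    renV-⟶ᵥ ρ (hd r) = hd (ren-⟶ ρ r)
    renV-⟶ᵥ ρ (tl r) = tl (renV-⟶ᵥ ρ r)

    renP-⟶ₚ : ∀ {Γ Δ} (ρ : Ren Γ Δ) {A B : Prp Γ} → A ⟶ₚ B → renP ρ A ⟶ₚ renP ρ B
    renP-⟶ₚ ρ (ξ-rel r) = ξ-rel (renV-⟶ᵥ ρ r)
    renP-⟶ₚ ρ (ξ-eqₗ r) = ξ-eqₗ (ren-⟶ ρ r)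
    renP-⟶ₚ ρ (ξ-eqᵣ r) = ξ-eqᵣ (ren-⟶ ρ r)
    renP-⟶ₚ ρ (ξ-∨ₗ r)  = ξ-∨ₗ (renP-⟶ₚ ρ r)
    renP-⟶ₚ ρ (ξ-∨ᵣ r)  = ξ-∨ᵣ (renP-⟶ₚ ρ r)
    renP-⟶ₚ ρ (ξ-¬ r)   = ξ-¬ (renP-⟶ₚ ρ r)

  ren-Convertible : ∀ {Γ Δ U} (ρ : Ren Γ Δ) {s t : Tm Γ U} →
                    Convertible s t → Convertible (ren ρ s) (ren ρ t)
  ren-Convertible ρ Star.ε           = Star.ε
  ren-Convertible ρ (fwd r Star.◅ rs) = fwd (ren-⟶ ρ r) Star.◅ ren-Convertible ρ rs
  ren-Convertible ρ (bwd r Star.◅ rs) = bwd (ren-⟶ ρ r) Star.◅ ren-Convertible ρ rs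

  renP-inst : ∀ {Γ Δ k} (ρ : Ren Γ Δ) (φ : PF k) (σ : Fin k → Prp Γ) →
              renP ρ (inst φ σ) ≡ inst φ (λ i → renP ρ (σ i))
  renP-inst ρ (pv i)   σ = refl
  renP-inst ρ (φ ∨′ ψ) σ = cong₂ _∨ₚ_ (renP-inst ρ φ σ) (renP-inst ρ ψ σ)
  renP-inst ρ (¬′ φ)   σ = cong ¬ₚ_ (renP-inst ρ φ σ)

  ren-⊢ : ∀ {Γ Δ} (ρ : Ren Γ Δ) {A : Prp Γ} → ⊢QF A → ⊢QF (renP ρ A)
  ren-⊢ ρ (ax-taut φ taut σ) = Eq.subst ⊢QF_ (sym (renP-inst ρ φ σ)) (ax-taut φ taut _)
  ren-⊢ ρ (ax-conv s t c)    = ax-conv _ _ (ren-Convertible ρ c)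
  ren-⊢ ρ (ax-caseT A s t)   = ax-caseT _ _ _
  ren-⊢ ρ (ax-caseF A s t)   = ax-caseF _ _ _
  ren-⊢ ρ (mp d e)           = mp (ren-⊢ ρ d) (ren-⊢ ρ e)
  ren-⊢ ρ (subst A s t d e)  =
    Eq.subst ⊢QF_ (sym (renP-⟦⟧ ρ A t))
      (subst (renP (extR ρ) A) (ren ρ s) (ren ρ t)
        (Eq.subst ⊢QF_ (renP-⟦⟧ ρ A s) (ren-⊢ ρ d)) (ren-⊢ ρ e))

  close-⊢ : ∀ {Γ U} {s t : Tm [] U} → ⊢QF (eq U s t) → ⊢QF (eq {Γ} U (close s) (close t))
  close-⊢ {s = s} {t} d =
    Eq.subst ⊢QF_ (cong₂ (eq _) (ren-cong (λ ()) s) (ren-cong (λ ()) t)) (ren-⊢ (λ ()) d)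

  _⇒′_ _⇔′_ : ∀ {k} → PF k → PF k → PF k
  φ ⇒′ ψ = (¬′ φ) ∨′ ψ
  φ ⇔′ ψ = ¬′ ((¬′ (φ ⇒′ ψ)) ∨′ (¬′ (ψ ⇒′ φ)))

  ⇔-refl : ∀ {Γ} (P : Prp Γ) → ⊢QF (P ⇔ₚ P)
  ⇔-refl P = ax-taut (p ⇔′ p) taut (λ _ → P)
    where
      p : PF 1
      p = pv zero
      taut : Tautology (p ⇔′ p)
      taut ρ with ρ zero
      ... | true  = refl
      ... | false = refl

  ⇔-trans : ∀ {Γ} {P Q R : Prp Γ} → ⊢QF (P ⇔ₚ Q) → ⊢QF (Q ⇔ₚ R) → ⊢QF (P ⇔ₚ R)
  ⇔-trans {P = P} {Q} {R} d e = mp e (mp d (ax-taut trans′ taut (lookup (P ∷ Q ∷ R ∷ []))))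
    where
      p q r : PF 3
      p = pv zero
      q = pv (suc zero)
      r = pv (suc (suc zero))
      trans′ = (p ⇔′ q) ⇒′ ((q ⇔′ r) ⇒′ (p ⇔′ r))
      taut : Tautology trans′
      taut ρ with ρ zero | ρ (suc zero) | ρ (suc (suc zero))
      ... | true  | true  | true  = refl
      ... | true  | true  | false = refl
      ... | true  | false | true  = refl
      ... | true  | false | false = refl
      ... | false | true  | true  = refl
      ... | false | true  | false = refl
      ... | false | false | true  = refl
      ... | false | false | false = refl

  -- The substitution rule applied to  X[s/x] ⇔ X,  whose instance at s is a tautology.
  ⇔-cong : ∀ {Γ U} (X : Prp (U ∷ Γ)) {s t : Tm Γ U} →
           ⊢QF (eq U s t) → ⊢QF ((X ⟦ s ⟧ₚ) ⇔ₚ (X ⟦ t ⟧ₚ))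
  ⇔-cong X {s} {t} e = Eq.subst ⊢QF_ Y⟦ t ⟧ (subst Y s t (Eq.subst ⊢QF_ (sym Y⟦ s ⟧) (⇔-refl _)) e)
    where
      Y = renP there (X ⟦ s ⟧ₚ) ⇔ₚ X
      Y⟦_⟧ : ∀ r → Y ⟦ r ⟧ₚ ≡ ((X ⟦ s ⟧ₚ) ⇔ₚ (X ⟦ r ⟧ₚ))
      Y⟦ r ⟧ = cong (_⇔ₚ (X ⟦ r ⟧ₚ)) (subP-weaken r (X ⟦ s ⟧ₚ))

  -- The interpretation W on open evidence and counter-evidence

  W⁺ : ∀ {m Δ} (A : Fm m) → Sub (ιs m) Δ → Tm Δ [ A ] → Tm Δ ⟨ A ⟩ → Prp Δ
  W⁺ (atom R ts) σ u v = rel R (subV σ ts)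
  W⁺ (∃f A) σ u v =
    W⁺ A (π₁ u ∷ˢ σ) (app (π₂ u) (app (app v u) (π₂ u))) (app (app v u) (π₂ u))
  W⁺ (A ∨f B) σ u v = W⁺ A σ (app (π₁ u) a) a ∨ₚ W⁺ B σ (app (π₂ u) b) b
    where
      a = app (app (π₁ v) (π₁ u)) (π₁ u)
      b = app (app (π₂ v) (π₂ u)) (π₂ u)
  W⁺ (¬f A) σ u v = ¬ₚ W⁺ A σ (app v (app u v)) (app u v)

  Wσ-close : ∀ {m n} (A : Fm m) (σ : Sub (ιs m) (ιs n)) (u : Tm [] [ A ]) (v : Tm [] ⟨ A ⟩) →
             Wσ A σ u v ≡ W⁺ A σ (close u) (close v)
  Wσ-close (atom R ts) σ u v = refl
  Wσ-close (∃f A)      σ u v = Wσ-close A _ _ _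
  Wσ-close (A ∨f B)    σ u v = cong₂ _∨ₚ_ (Wσ-close A σ _ _) (Wσ-close B σ _ _)
  Wσ-close (¬f A)      σ u v = cong ¬ₚ_ (Wσ-close A σ _ _)

  subP-W⁺ : ∀ {m Γ Δ} (A : Fm m) {σ : Sub (ιs m) Γ} (τ : Sub Γ Δ) {σ' : Sub (ιs m) Δ} →
            (λ x → sub τ (σ x)) ≗ₛ σ' → (u : Tm Γ [ A ]) (v : Tm Γ ⟨ A ⟩) →
            subP τ (W⁺ A σ u v) ≡ W⁺ A σ' (sub τ u) (sub τ v)
  subP-W⁺ (atom R ts) {σ} τ h u v = cong (rel R) (trans (subV-sub τ σ ts) (subV-cong h ts))
  subP-W⁺ (∃f A)          τ h u v = subP-W⁺ A τ h′ _ _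
    where
      h′ : (λ x → sub τ ((π₁ u ∷ˢ _) x)) ≗ₛ (π₁ (sub τ u) ∷ˢ _)
      h′ here      = refl
      h′ (there x) = h x
  subP-W⁺ (A ∨f B)        τ h u v = cong₂ _∨ₚ_ (subP-W⁺ A τ h _ _) (subP-W⁺ B τ h _ _)
  subP-W⁺ (¬f A)          τ h u v = cong ¬ₚ_ (subP-W⁺ A τ h _ _)

  W⁺-congˡ : ∀ {m Δ} (A : Fm m) (σ : Sub (ιs m) Δ) {u₀ u₁ : Tm Δ [ A ]} (v : Tm Δ ⟨ A ⟩) →
             ⊢QF (eq [ A ] u₀ u₁) → ⊢QF (W⁺ A σ u₀ v ⇔ₚ W⁺ A σ u₁ v)
  W⁺-congˡ A σ {u₀} {u₁} v e =
    Eq.subst ⊢QF_ (cong₂ _⇔ₚ_ (X⟦ u₀ ⟧) (X⟦ u₁ ⟧)) (⇔-cong X e)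
    where
      X = W⁺ A (λ x → ren there (σ x)) (var here) (ren there v)
      X⟦_⟧ : ∀ u → X ⟦ u ⟧ₚ ≡ W⁺ A σ u v
      X⟦ u ⟧ = trans (subP-W⁺ A (u ∷ˢ var) (λ x → sub-weaken u (σ x)) (var here) (ren there v))
                     (cong (W⁺ A σ u) (sub-weaken u v))

  W⁺-congʳ : ∀ {m Δ} (A : Fm m) (σ : Sub (ιs m) Δ) (u : Tm Δ [ A ]) {v₀ v₁ : Tm Δ ⟨ A ⟩} →
             ⊢QF (eq ⟨ A ⟩ v₀ v₁) → ⊢QF (W⁺ A σ u v₀ ⇔ₚ W⁺ A σ u v₁)
  W⁺-congʳ A σ u {v₀} {v₁} e =
    Eq.subst ⊢QF_ (cong₂ _⇔ₚ_ (X⟦ v₀ ⟧) (X⟦ v₁ ⟧)) (⇔-cong X e)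
    where
      X = W⁺ A (λ x → ren there (σ x)) (ren there u) (var here)
      X⟦_⟧ : ∀ v → X ⟦ v ⟧ₚ ≡ W⁺ A σ u v
      X⟦ v ⟧ = trans (subP-W⁺ A (v ∷ˢ var) (λ x → sub-weaken v (σ x)) (ren there u) (var here))
                     (cong (λ u′ → W⁺ A σ u′ v) (sub-weaken v u))

proposition3 : (L : Vocabulary) → let open Lang L in
    (n : ℕ) (A : Fm n) (u₀ u₁ : Tm [] [ A ]) (v₀ v₁ : Tm [] ⟨ A ⟩) →
    ⊢QF (eq [ A ] u₀ u₁) → ⊢QF (eq ⟨ A ⟩ v₀ v₁) →
    ⊢QF (W A u₀ v₀ ⇔ₚ W A u₁ v₁)
proposition3 L n A u₀ u₁ v₀ v₁ hu hv =
  Eq.subst ⊢QF_ (sym (cong₂ _⇔ₚ_ (Wσ-close A var u₀ v₀) (Wσ-close A var u₁ v₁)))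
    (⇔-trans (W⁺-congˡ A var (close v₀) (close-⊢ hu))
             (W⁺-congʳ A var (close u₁) (close-⊢ hv)))
  where open Metatheory L
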